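{- For every well partial order $X$, $$\mathbf{w}(M^{r}(X))\ge \sup_{x\in X,\ n<\omega}\Big(\mathbf{w}\big(M^{r}(X)_{\perp [\![x]\!]}\big)\cdot n+1\Big),$$ where $[\![x]\!]$ is the singleton multiset containing $x$ once and $M^{r}(X)_{\perp [\![x]\!]}$ is the set of multisets in $M^{r}(X)$ incomparable to $[\![x]\!]$, with the induced order.
   Context: A well partial order (wpo) is a partial order with no infinite bad sequence. For a wpo $Y$, the width $\mathbf{w}(Y)$ is the rank of the empty sequence in the well-founded tree of finite antichains (pairwise incomparable sequences) of $Y$, ordered so that a sequence lies below its proper prefixes (rank $0$ for non-extendable nodes, otherwise the least ordinal exceeding ranks of one-step extensions); equivalently $\mathbf{w}(Y)=\sup_{y\in Y}(\mathbf{w}(\{z:z\perp y\})+1)$. $M^{r}(X)$ is the set of finite multisets over $X$ ordered by the multiset ordering: $m\le_r m'$ iff $m=m'$, or for every $x\in m\setminus(m\cap m')$ there is $y\in m'\setminus(m\cap m')$ with $x<y$. The product $\cdot$ is ordinary ordinal multiplication. -}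

module Defs where

open import Data.Nat using (ℕ; zero; suc; _<_)
open import Data.Product using (Σ; ∃; ∃-syntax; _×_; _,_; proj₁; proj₂)
open import Data.List using (List; []; _∷_; _++_)
open import Data.List.Relation.Binary.Permutation.Propositional using (_↭_)
open import Data.Empty using (⊥)
open import Data.List.Membership.Propositional using (_∈_)
open import Data.List.Relation.Unary.All using (All)
open import Data.Maybe using (Maybe; nothing; just)
open import Data.Sum using (_⊎_)
open import Relation.Nullary using (¬_; Dec)
open import Relation.Binary.PropositionalEquality using (_≡_; _≢_)
open import Relation.Binary.Structures using (IsPartialOrder)

-- Classical logic, taken as an explicit hypothesis (the paper is classical)

Classical : Set₁
Classical = (P : Set) → Dec P

-- Ordinals as Brouwer trees; `lim I f` denotes the supremum of the family f
-- (over an arbitrary index type I, possibly empty).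

data Ord : Set₁ where
  ozero : Ord
  osuc  : Ord → Ord
  lim   : (I : Set) → (I → Ord) → Ord

-- Order on Brouwer trees (inductive, Kraus–Nordvall Forsberg–Xu style)
data _≤o_ : Ord → Ord → Set₁ where
  z≤o   : ∀ {b} → ozero ≤o b
  s≤o   : ∀ {a b} → a ≤o b → osuc a ≤o osuc b
  ≤lim  : ∀ {a I f} (i : I) → a ≤o f i → a ≤o lim I f
  lim≤  : ∀ {I f b} → (∀ i → f i ≤o b) → lim I f ≤o b

-- ordinal addition (recursion on the right argument; `lim` is a sup, so the
-- extra `nothing` branch makes α + sup ∅ = α)
_+o_ : Ord → Ord → Ord
a +o ozero     = a
a +o osuc b    = osuc (a +o b)
a +o lim I f   = lim (Maybe I) g
  where
  g : Maybe I → Ord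
  g nothing  = a
  g (just i) = a +o f i

_·ℕ_ : Ord → ℕ → Ord
a ·ℕ zero  = ozero
a ·ℕ suc n = (a ·ℕ n) +o a

-- Width of a (quasi/partial) order (Y, R): rank of [] in the tree of finite
-- antichains.  A node is a finite antichain (stored last-element-first);
-- its one-step extensions are the y incomparable to every element of it.

module _ {Y : Set} (R : Y → Y → Set) where

  Incomp : Y → Y → Set
  Incomp a b = ¬ R a b × ¬ R b a

  Ext : List Y → Set
  Ext s = Σ Y (λ y → All (Incomp y) s)

  data HasRank (s : List Y) : Ord → Set₁ where
    rank : (r : Ext s → Ord)
         → ((e : Ext s) → HasRank (proj₁ e ∷ s) (r e))
         → HasRank s (lim (Ext s) (λ e → osuc (r e)))

  Width : Ord → Set₁
  Width α = HasRank [] α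

record WPO : Set₁ where
  field
    Carrier        : Set
    _≤_            : Carrier → Carrier → Set
    isPartialOrder : IsPartialOrder _≡_ _≤_
    noBadSeq       : (f : ℕ → Carrier) → ∃[ i ] ∃[ j ] (i < j × f i ≤ f j)

  _<X_ : Carrier → Carrier → Set
  x <X y = x ≤ y × x ≢ y

  -- Finite multisets over X, as lists up to permutation (_↭_)

  MR : Set
  MR = List Carrier

  -- multiset ordering:  m ≤r m'  iff  m = m' (as multisets), or, writing
  -- m = c + a and m' = c + b with c = m ∩ m' (equivalently a, b share no
  -- element), every x ∈ a = m ∖ (m ∩ m') is below some y ∈ b = m' ∖ (m ∩ m').
  _≤r_ : MR → MR → Set
  m ≤r m' = (m ↭ m')
          ⊎ (∃[ c ] ∃[ a ] ∃[ b ]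
               ( m ↭ (c ++ a) × m' ↭ (c ++ b)
               × (∀ x → x ∈ a → x ∈ b → ⊥)
               × (∀ x → x ∈ a → ∃[ y ] (y ∈ b × x <X y))))

  ⟦_⟧ : Carrier → MR
  ⟦ x ⟧ = x ∷ []

  MR⊥ : Carrier → Set
  MR⊥ x = Σ MR (λ m → Incomp _≤r_ m ⟦ x ⟧)

  _≤r⊥_ : ∀ {x} → MR⊥ x → MR⊥ x → Set
  m ≤r⊥ m' = proj₁ m ≤r proj₁ m'

-- Fix x and n; we show w(M^r(X)_⊥[[x]]) · n < w(M^r(X)) by bounding the rank of the antichain
-- [x^n] from below, by induction on n.  For an antichain s of multisets each containing x at
-- least k+1 times, and nothing else above x, pick z ⊥ x maximal among the elements of s that are
-- incomparable to x, and a number N exceeding the size of s.  Then m ↦ x^k + z^N + m sends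
-- antichains of M^r(X)_⊥[[x]] to antichains of multisets incomparable to all of s: x^k + z^N + m
-- has too few copies of x to lie above a member of s, and too many copies of z to lie below
-- one.  The images again contain x at least k times, so every node of the antichain tree
-- reached this way has rank at least w(M^r(X)_⊥[[x]]) · k by induction, and stacking the
-- embedded tree on top of it adds w(M^r(X)_⊥[[x]]).
module Submission where

open import Defs
open import Data.Nat using (ℕ; zero; suc; _∸_; z≤n; s≤s) renaming (_≤_ to _≤ℕ_)
open import Data.Nat.Properties using (≤-trans; ≤-reflexive; m≤m+n; m≤n+m; m≤n⇒m≤1+n)
open import Data.Product using (∃-syntax; _×_; _,_; proj₁; proj₂)
open import Data.List using (List; []; _∷_; _++_; replicate; concat; length; map)
open import Data.List.Properties using (++-assoc; ++-identityʳ; length-++)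
open import Data.List.Relation.Binary.Permutation.Propositional using (_↭_; ↭-refl; ↭-sym; ↭-trans; ↭-reflexive; prep)
import Data.List.Relation.Binary.Permutation.Propositional.Properties as ↭ₚ
open import Data.List.Membership.Propositional using (_∈_; _∉_)
open import Data.List.Membership.Propositional.Properties using (∈-∃++; ∈-++⁻; ∈-++⁺ˡ; ∈-++⁺ʳ; ∈-concat⁺′)
open import Data.List.Relation.Unary.Any using (here; there)
open import Data.List.Relation.Unary.All as All using (All; []; _∷_)
import Data.List.Relation.Unary.All.Properties as Allₚ
open import Data.Maybe using (nothing; just)
open import Data.Sum using (_⊎_; inj₁; inj₂)
open import Data.Empty using (⊥; ⊥-elim)
open import Relation.Nullary using (¬_; yes; no)
open import Relation.Binary.Definitions using (DecidableEquality)
open import Relation.Binary.PropositionalEquality using (_≡_; refl; sym; trans; cong; subst)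
open import Relation.Binary.Structures using (IsPartialOrder)

module _ {Y Z : Set} {R : Y → Y → Set} {S : Z → Z → Set}
         (f : Z → Y) (f-incomp : ∀ {a b} → Incomp S a b → Incomp R (f a) (f b))
         (s : List Y) (f-incomp-s : ∀ a → All (Incomp R (f a)) s)
         (γ : Ord) (γ≤rank : ∀ t {β} → HasRank R (map f t ++ s) β → γ ≤o β) where

  +o-≤-rank : ∀ {t δ β} → HasRank S t δ → HasRank R (map f t ++ s) β → (γ +o δ) ≤o β
  +o-≤-rank {t} (rank r h) (rank r′ h′) = lim≤ λ
    { nothing  → γ≤rank t (rank r′ h′)
    ; (just e) → ≤lim (image e) (s≤o (+o-≤-rank (h e) (h′ (image e))))
    }
    where
    image : Ext S t → Ext R (map f t ++ s)
    image (a , a⊥t) = f a , Allₚ.++⁺ (Allₚ.map⁺ (All.map f-incomp a⊥t)) (f-incomp-s a)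

module _ {A : Set} where

  replicate-split : ∀ (a : A) {j n} → j ≤ℕ n → replicate (suc n) a ≡ replicate j a ++ a ∷ replicate (n ∸ j) a
  replicate-split a z≤n     = refl
  replicate-split a (s≤s p) = cong (a ∷_) (replicate-split a p)

  length-≤-concat : ∀ {u : List A} {us} → u ∈ us → length u ≤ℕ length (concat us)
  length-≤-concat {u} (here refl) = ≤-trans (m≤m+n (length u) _) (≤-reflexive (sym (length-++ u)))
  length-≤-concat {us = u′ ∷ _} (there p) =
    ≤-trans (length-≤-concat p) (≤-trans (m≤n+m _ (length u′)) (≤-reflexive (sym (length-++ u′))))

  split-occurrences : DecidableEquality A → ∀ (a : A) u →
    ∃[ j ] ∃[ r ] (u ↭ replicate j a ++ r × a ∉ r × j ≤ℕ length u)
  split-occurrences _≟_ a [] = 0 , [] , ↭-refl , (λ ()) , z≤n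
  split-occurrences _≟_ a (b ∷ u) with split-occurrences _≟_ a u | b ≟ a
  ... | j , r , u↭ , a∉r , j≤ | yes refl = suc j , r , prep a u↭ , a∉r , s≤s j≤
  ... | j , r , u↭ , a∉r , j≤ | no b≢a =
    j , b ∷ r , ↭-trans (prep b u↭) (↭-sym (↭ₚ.shift b (replicate j a) r)) , a∉b∷r , m≤n⇒m≤1+n j≤
    where
    a∉b∷r : a ∉ b ∷ r
    a∉b∷r (here a≡b) = b≢a (sym a≡b)
    a∉b∷r (there a∈r) = a∉r a∈r

module _ (X : WPO) where
  open WPO X
  module PO = IsPartialOrder isPartialOrder

  ≤r-resp-↭ : ∀ {u u′ v v′} → u ↭ u′ → v ↭ v′ → u ≤r v → u′ ≤r v′
  ≤r-resp-↭ p q (inj₁ u↭v) = inj₁ (↭-trans (↭-sym p) (↭-trans u↭v q))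
  ≤r-resp-↭ p q (inj₂ (c , a , b , u↭ , v↭ , disj , dom)) =
    inj₂ (c , a , b , ↭-trans (↭-sym p) u↭ , ↭-trans (↭-sym q) v↭ , disj , dom)

  ∷-cancel-≤r : ∀ w {u v} → (w ∷ u) ≤r (w ∷ v) → u ≤r v
  ∷-cancel-≤r w (inj₁ p) = inj₁ (↭ₚ.drop-∷ p)
  ∷-cancel-≤r w (inj₂ (c , a , b , u↭ , v↭ , disj , dom)) with ∈-∃++ w∈c
    where
    w∈c : w ∈ c
    w∈c with ∈-++⁻ c (↭ₚ.∈-resp-↭ u↭ (here refl)) | ∈-++⁻ c (↭ₚ.∈-resp-↭ v↭ (here refl))
    ... | inj₁ w∈c | _       = w∈c
    ... | inj₂ _   | inj₁ w∈c = w∈c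
    ... | inj₂ w∈a | inj₂ w∈b = ⊥-elim (disj w w∈a w∈b)
  ... | c₁ , c₂ , refl = inj₂ (c₁ ++ c₂ , a , b , drop u↭ , drop v↭ , disj , dom)
    where
    drop : ∀ {t e} → w ∷ t ↭ (c₁ ++ w ∷ c₂) ++ e → t ↭ (c₁ ++ c₂) ++ e
    drop {e = e} p = ↭ₚ.drop-∷ (↭-trans p (↭ₚ.++⁺ʳ e (↭ₚ.shift w c₁ c₂)))

  ++-cancelˡ-≤r : ∀ Q {u v} → (Q ++ u) ≤r (Q ++ v) → u ≤r v
  ++-cancelˡ-≤r []      le = le
  ++-cancelˡ-≤r (w ∷ Q) le = ++-cancelˡ-≤r Q (∷-cancel-≤r w le)

  ++-incomp-≤r : ∀ Q {u v} → Incomp _≤r_ u v → Incomp _≤r_ (Q ++ u) (Q ++ v)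
  ++-incomp-≤r Q (u≰v , v≰u) = (λ le → u≰v (++-cancelˡ-≤r Q le)) , (λ le → v≰u (++-cancelˡ-≤r Q le))

  ≤r-dominated : ∀ {u v w} → u ≤r v → w ∈ u → w ∉ v → ∃[ y ] (y ∈ v × w <X y)
  ≤r-dominated (inj₁ u↭v) w∈u w∉v = ⊥-elim (w∉v (↭ₚ.∈-resp-↭ u↭v w∈u))
  ≤r-dominated (inj₂ (c , a , b , u↭ , v↭ , _ , dom)) w∈u w∉v with ∈-++⁻ c (↭ₚ.∈-resp-↭ u↭ w∈u)
  ... | inj₁ w∈c = ⊥-elim (w∉v (↭ₚ.∈-resp-↭ (↭-sym v↭) (∈-++⁺ˡ w∈c)))
  ... | inj₂ w∈a with dom _ w∈a
  ...   | y , y∈b , w<y = y , ↭ₚ.∈-resp-↭ (↭-sym v↭) (∈-++⁺ʳ c y∈b) , w<y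

  ≤r-excess-dominated : ∀ {u v w} Q {u′ v′} → u ≤r v → u ↭ Q ++ u′ → v ↭ Q ++ v′ →
    w ∈ u′ → w ∉ v′ → ∃[ y ] (y ∈ v′ × w <X y)
  ≤r-excess-dominated Q le u↭ v↭ = ≤r-dominated (++-cancelˡ-≤r Q (≤r-resp-↭ u↭ v↭ le))

  ⟦⟧-≤r-member : ∀ {x m} → x ∈ m → ⟦ x ⟧ ≤r m
  ⟦⟧-≤r-member {x} x∈m with ∈-∃++ x∈m
  ... | c₁ , c₂ , refl = inj₂ (⟦ x ⟧ , [] , c₁ ++ c₂ , ↭-refl , ↭ₚ.shift x c₁ c₂ , (λ _ ()) , (λ _ ()))

  ⟦⟧-≤r-nonmember : ∀ {x y m} → x ∉ m → y ∈ m → x ≤ y → ⟦ x ⟧ ≤r m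
  ⟦⟧-≤r-nonmember {x} {y} {m} x∉m y∈m x≤y = inj₂ ([] , ⟦ x ⟧ , m , ↭-refl , ↭-refl , disj , dom)
    where
    disj : ∀ w → w ∈ ⟦ x ⟧ → w ∈ m → ⊥
    disj w (here refl) = x∉m
    dom : ∀ w → w ∈ ⟦ x ⟧ → ∃[ y′ ] (y′ ∈ m × w <X y′)
    dom w (here refl) = y , y∈m , x≤y , λ x≡y → x∉m (subst (_∈ m) (sym x≡y) y∈m)

  module _ (em : Classical) where

    ⟦⟧-≤r-above : ∀ {x y m} → y ∈ m → x ≤ y → ⟦ x ⟧ ≤r m
    ⟦⟧-≤r-above {x} {m = m} y∈m x≤y with em (x ∈ m)
    ... | yes x∈m = ⟦⟧-≤r-member x∈m
    ... | no x∉m = ⟦⟧-≤r-nonmember x∉m y∈m x≤y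

    maximal-above : (P : Carrier → Set) → ∀ L {z₀} → P z₀ →
      ∃[ z ] (P z × z₀ ≤ z × (∀ y → y ∈ L → P y → ¬ z <X y))
    maximal-above P [] {z₀} Pz₀ = z₀ , Pz₀ , PO.refl , λ _ ()
    maximal-above P (y ∷ L) Pz₀ with maximal-above P L Pz₀
    ... | z , Pz , z₀≤z , z-max with em (P y × z <X y)
    ...   | no ¬Py×z<y = z , Pz , z₀≤z , max
      where
      max : ∀ w → w ∈ y ∷ L → P w → ¬ z <X w
      max w (here refl) Pw z<w = ¬Py×z<y (Pw , z<w)
      max w (there w∈L) = z-max w w∈L
    ...   | yes (Py , z<y) with maximal-above P L Py
    ...     | z′ , Pz′ , y≤z′ , z′-max = z′ , Pz′ , PO.trans z₀≤z (PO.trans (proj₁ z<y) y≤z′) , max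
      where
      max : ∀ w → w ∈ y ∷ L → P w → ¬ z′ <X w
      max w (here refl) _ (z′≤y , z′≢y) = z′≢y (PO.antisym z′≤y y≤z′)
      max w (there w∈L) = z′-max w w∈L

    module _ (x : Carrier) where

      NoneAbove : List Carrier → Set
      NoneAbove = All (λ y → ¬ x ≤ y)

      ⟦⟧-incomp⇒noneAbove : ∀ {m} → Incomp _≤r_ m ⟦ x ⟧ → NoneAbove m
      ⟦⟧-incomp⇒noneAbove (_ , ⟦x⟧≰m) = All.tabulate λ y∈m x≤y → ⟦x⟧≰m (⟦⟧-≤r-above y∈m x≤y)

      ⟦⟧-incomp⇒∃incomp : ∀ {m} → Incomp _≤r_ m ⟦ x ⟧ → ∃[ y ] (y ∈ m × Incomp _≤_ y x)
      ⟦⟧-incomp⇒∃incomp {m} m⊥x with em (∃[ y ] (y ∈ m × ¬ y ≤ x))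
      ... | yes (y , y∈m , y≰x) = y , y∈m , y≰x , All.lookup (⟦⟧-incomp⇒noneAbove m⊥x) y∈m
      ... | no ¬∃ = ⊥-elim (proj₁ m⊥x (inj₂ ([] , m , ⟦ x ⟧ , ↭-refl , ↭-refl , disj , dom)))
        where
        x∉m : x ∉ m
        x∉m x∈m = All.lookup (⟦⟧-incomp⇒noneAbove m⊥x) x∈m PO.refl
        disj : ∀ w → w ∈ m → w ∈ ⟦ x ⟧ → ⊥
        disj w w∈m (here refl) = x∉m w∈m
        below : ∀ {w} → w ∈ m → w ≤ x
        below {w} w∈m with em (w ≤ x)
        ... | yes w≤x = w≤x
        ... | no w≰x = ⊥-elim (¬∃ (w , w∈m , w≰x))
        dom : ∀ w → w ∈ m → ∃[ y ] (y ∈ ⟦ x ⟧ × w <X y)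
        dom w w∈m = x , here refl , below w∈m , λ w≡x → x∉m (subst (_∈ m) w≡x w∈m)

      record Admissible (k : ℕ) (e : MR) : Set where
        field
          rest           : MR
          ↭-xs++rest     : e ↭ replicate k x ++ rest
          ≡x-or-notAbove : All (λ y → y ≡ x ⊎ ¬ x ≤ y) e

      admissible-replicate : ∀ n → Admissible n (replicate n x)
      admissible-replicate n = record
        { rest = []
        ; ↭-xs++rest = ↭-reflexive (sym (++-identityʳ (replicate n x)))
        ; ≡x-or-notAbove = Allₚ.replicate⁺ n (inj₁ refl)
        }

      admissible-pred : ∀ {k e} → Admissible (suc k) e → Admissible k e
      admissible-pred {k} a = record
        { rest = x ∷ rest
        ; ↭-xs++rest = ↭-trans ↭-xs++rest (↭-sym (↭ₚ.shift x (replicate k x) rest))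
        ; ≡x-or-notAbove = ≡x-or-notAbove
        }
        where open Admissible a

      padded : ℕ → List Carrier → MR⊥ x → MR
      padded k pad m = replicate k x ++ (pad ++ proj₁ m)

      padded-noneAbove : ∀ {pad} → NoneAbove pad → (m : MR⊥ x) → NoneAbove (pad ++ proj₁ m)
      padded-noneAbove pad↑ (_ , m⊥x) = Allₚ.++⁺ pad↑ (⟦⟧-incomp⇒noneAbove m⊥x)

      admissible-padded : ∀ k {pad} → NoneAbove pad → (m : MR⊥ x) → Admissible k (padded k pad m)
      admissible-padded k {pad} pad↑ m = record
        { rest = pad ++ proj₁ m
        ; ↭-xs++rest = ↭-refl
        ; ≡x-or-notAbove = Allₚ.++⁺ (Allₚ.replicate⁺ k (inj₁ refl)) (All.map inj₂ (padded-noneAbove pad↑ m))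
        }

      padded-incomp : ∀ k pad {m m′ : MR⊥ x} → Incomp (_≤r⊥_ {x}) m m′ →
                      Incomp _≤r_ (padded k pad m) (padded k pad m′)
      padded-incomp k pad m⊥m′ = ++-incomp-≤r (replicate k x) (++-incomp-≤r pad m⊥m′)

      admissible≰padded : ∀ {k pad e} → NoneAbove pad → (m : MR⊥ x) → Admissible (suc k) e →
                          ¬ e ≤r padded k pad m
      admissible≰padded {k} {e = e} pad↑ m a le
        with ≤r-excess-dominated (replicate k x) le e↭ ↭-refl (here refl)
                                 (λ x∈ → All.lookup (padded-noneAbove pad↑ m) x∈ PO.refl)
        where
        open Admissible a
        e↭ : e ↭ replicate k x ++ x ∷ rest
        e↭ = ↭-trans ↭-xs++rest (↭-sym (↭ₚ.shift x (replicate k x) rest))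
      ... | y , y∈ , x≤y , _ = All.lookup (padded-noneAbove pad↑ m) y∈ x≤y

      -- e has fewer than L+1 copies of z, so some element of e lies strictly above z; but it is
      -- either x, or below x, or incomparable to x, and z ⊥ x is maximal among the latter.
      padded≰admissible : ∀ {k L z e} → Incomp _≤_ z x → (∀ y → y ∈ e → Incomp _≤_ y x → ¬ z <X y) →
        length e ≤ℕ L → (m : MR⊥ x) → Admissible (suc k) e → ¬ padded k (replicate (suc L) z) m ≤r e
      padded≰admissible {k} {L} {z} {e} (z≰x , _) z-max |e|≤L m a le
        with split-occurrences (λ a b → em (a ≡ b)) z e
      ... | j , r , e↭ , z∉r , j≤|e|
        with ≤r-excess-dominated (replicate j z) le padded↭ e↭ (∈-++⁺ʳ (replicate k x) (here refl)) z∉r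
        where
        padded↭ : padded k (replicate (suc L) z) m ↭
                  replicate j z ++ (replicate k x ++ (z ∷ replicate (L ∸ j) z ++ proj₁ m))
        padded↭ = ↭-trans
          (↭-reflexive (cong (replicate k x ++_)
            (trans (cong (_++ proj₁ m) (replicate-split z (≤-trans j≤|e| |e|≤L)))
                   (++-assoc (replicate j z) _ (proj₁ m)))))
          (↭ₚ.shifts (replicate k x) (replicate j z))
      ... | y , y∈r , z<y = excluded (All.lookup (Admissible.≡x-or-notAbove a) y∈e)
        where
        y∈e : y ∈ e
        y∈e = ↭ₚ.∈-resp-↭ (↭-sym e↭) (∈-++⁺ʳ (replicate j z) y∈r)
        excluded : y ≡ x ⊎ ¬ x ≤ y → ⊥
        excluded (inj₁ refl) = z≰x (proj₁ z<y)
        excluded (inj₂ x≰y) with em (y ≤ x)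
        ... | yes y≤x = z≰x (PO.trans (proj₁ z<y) y≤x)
        ... | no y≰x = z-max y y∈e (y≰x , x≰y) z<y

      record Padding (k : ℕ) (s : List MR) : Set where
        field
          pad           : List Carrier
          pad-noneAbove : NoneAbove pad
          padded-incomp-s : ∀ m → All (Incomp _≤r_ (padded k pad m)) s

      -- Without elements incomparable to x, M^r(X)_⊥[[x]] is empty and any padding will do.
      padding : ∀ {k s} → All (Admissible (suc k)) s → Padding k s
      padding {s = s} adm with em (∃[ z ] Incomp _≤_ z x)
      ... | no ¬∃ = record
        { pad = []
        ; pad-noneAbove = []
        ; padded-incomp-s = λ (_ , m⊥x) → ⊥-elim (¬∃ (let y , _ , y⊥x = ⟦⟧-incomp⇒∃incomp m⊥x in y , y⊥x))
        }
      ... | yes (z₀ , z₀⊥x) with maximal-above (λ y → Incomp _≤_ y x) (concat s) z₀⊥x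
      ...   | z , z⊥x , _ , z-max = record
        { pad = replicate (suc L) z
        ; pad-noneAbove = pad↑
        ; padded-incomp-s = λ m → All.tabulate λ e∈s →
            padded≰admissible z⊥x (λ y y∈e → z-max y (∈-concat⁺′ y∈e e∈s)) (length-≤-concat e∈s) m
                              (All.lookup adm e∈s)
          , admissible≰padded pad↑ m (All.lookup adm e∈s)
        }
        where
        L : ℕ
        L = length (concat s)
        pad↑ : NoneAbove (replicate (suc L) z)
        pad↑ = Allₚ.replicate⁺ (suc L) (proj₂ z⊥x)

      ·ℕ-≤-rank : ∀ {ρ} → Width (_≤r⊥_ {x}) ρ →
                  ∀ k {s β} → All (Admissible k) s → HasRank _≤r_ s β → (ρ ·ℕ k) ≤o β
      ·ℕ-≤-rank W zero    _   _ = z≤o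
      ·ℕ-≤-rank {ρ} W (suc k) {s} adm h =
        +o-≤-rank (padded k pad) (λ {m} {m′} → padded-incomp k pad {m} {m′}) s padded-incomp-s
                  (ρ ·ℕ k) below W h
        where
        open Padding (padding adm)
        below : ∀ t {β} → HasRank _≤r_ (map (padded k pad) t ++ s) β → (ρ ·ℕ k) ≤o β
        below t = ·ℕ-≤-rank W k (Allₚ.++⁺ (Allₚ.map⁺ (All.universal (admissible-padded k pad-noneAbove) t))
                                          (All.map admissible-pred adm))

mainTheorem9 : Classical → (X : WPO) → let open WPO X in
    (α : Ord) → Width _≤r_ α →
    (ρ : Carrier → Ord) → ((x : Carrier) → Width (_≤r⊥_ {x}) (ρ x)) →
    lim (Carrier × ℕ) (λ p → osuc (ρ (proj₁ p) ·ℕ proj₂ p)) ≤o α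
mainTheorem9 em X _ (rank r h) ρ W = lim≤ λ (x , n) →
  let xⁿ = replicate n x , [] in
  ≤lim xⁿ (s≤o (·ℕ-≤-rank X em x (W x) n (admissible-replicate X em x n ∷ []) (h xⁿ)))
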